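{- Let $A$ be a metric algebra and $\theta$ a congruential pseudometric on $A$. Then there is a lattice isomorphism between $\mathrm{Con}(A/\theta)$ and $(\mathrm{Con}\,A)_{\ge\theta}=\{\rho\in\mathrm{Con}\,A:\theta\sqsubseteq\rho\}$.
   Context: Fix an algebraic signature $\Sigma$. A metric algebra is a $\Sigma$-algebra $A$ with an extended metric $d\colon A\times A\to[0,\infty]$. A congruential pseudometric on $A$ is an extended pseudometric $\theta$ on $A$ with $\theta(x,y)\le d(x,y)$ for all $x,y$ such that $\{\theta=0\}$ is a congruence of the $\Sigma$-algebra $A$. $\mathrm{Con}\,A$ is the set of congruential pseudometrics on $A$, ordered reversely pointwise: $\theta_1\sqsubseteq\theta_2$ iff $\theta_1(a,b)\ge\theta_2(a,b)$ for all $a,b\in A$. $A/\theta$ is the metric algebra of classes of the relation $\theta=0$ with metric $([a],[b])\mapsto\theta(a,b)$ and operations $\sigma([a_1],\dots,[a_n])=[\sigma(a_1,\dots,a_n)]$. -}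

module Defs where

open import Data.Nat using (ℕ)
open import Data.Fin using (Fin)
open import Data.Product using (Σ; ∃; _×_; _,_; proj₁; proj₂; Σ-syntax; ∃-syntax)
open import Data.Rational using (ℚ; 0ℚ; _<_; _≤_; _+_)
open import Data.Rational.Properties
  using (<-dense; <-≤-trans; <⇒≤; ≤-trans; +-mono-<; +-monoˡ-<; +-identityʳ)
open import Relation.Binary.PropositionalEquality using (subst)

-- Extended non-negative reals [0,∞], as open upper Dedekind cuts of
-- positive rationals: x ∈ [0,∞] is represented by U = {q ∈ ℚ | x < q}.
-- (∞ is the empty cut, 0 the cut of all positive rationals.)

record ℝ≥0∞ : Set₁ where
  field
    U       : ℚ → Set
    U-pos   : ∀ {q} → U q → 0ℚ < q
    U-up    : ∀ {q r} → U q → q ≤ r → U r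
    U-round : ∀ {q} → U q → ∃[ r ] (r < q × U r)
open ℝ≥0∞ public

infix 4 _≤∞_ _≃∞_
_≤∞_ : ℝ≥0∞ → ℝ≥0∞ → Set
x ≤∞ y = ∀ q → U y q → U x q

_≃∞_ : ℝ≥0∞ → ℝ≥0∞ → Set
x ≃∞ y = (x ≤∞ y) × (y ≤∞ x)

0∞ : ℝ≥0∞
0∞ = record
  { U = λ q → 0ℚ < q
  ; U-pos = λ p → p
  ; U-up = λ p q≤r → <-≤-trans p q≤r
  ; U-round = λ {q} p → let (m , 0<m , m<q) = <-dense p in m , m<q , 0<m
  }

infixl 6 _⊕_
_⊕_ : ℝ≥0∞ → ℝ≥0∞ → ℝ≥0∞
x ⊕ y = record
  { U = λ q → ∃[ r ] ∃[ s ] (U x r × U y s × r + s ≤ q)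
  ; U-pos = λ { (r , s , ur , us , le) →
      <-≤-trans (subst (_< r + s) (+-identityʳ 0ℚ)
                  (+-mono-< (U-pos x ur) (U-pos y us))) le }
  ; U-up = λ { (r , s , ur , us , le) q≤t → r , s , ur , us , ≤-trans le q≤t }
  ; U-round = λ { (r , s , ur , us , le) →
      let (r' , r'<r , ur') = U-round x ur in
      r' + s , <-≤-trans (+-monoˡ-< s r'<r) le , r' , s , ur' , us , ≤-refl' }
  }
  where
    open import Data.Rational.Properties using (≤-refl)
    ≤-refl' : ∀ {p} → p ≤ p
    ≤-refl' = ≤-refl

record Signature : Set₁ where
  field
    Op    : Set
    arity : Op → ℕ
open Signature public

-- A metric algebra is represented as a setoid-style object: a carrier
-- whose equality is  d x y ≃ 0 , an extended (pseudo)metric d, and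
-- operations that are well defined w.r.t. that equality.
record IsPseudometric {A : Set} (d : A → A → ℝ≥0∞) : Set where
  field
    refl0 : ∀ x → d x x ≃∞ 0∞
    sym   : ∀ x y → d x y ≃∞ d y x
    tri   : ∀ x y z → d x z ≤∞ d x y ⊕ d y z

Compatible : (Σ' : Signature) {A : Set} →
             ((f : Op Σ') → (Fin (arity Σ' f) → A) → A) →
             (A → A → ℝ≥0∞) → Set
Compatible Σ' ⟦_⟧ ρ = ∀ f (xs ys : Fin (arity Σ' f) → _) →
  (∀ i → ρ (xs i) (ys i) ≃∞ 0∞) → ρ (⟦ f ⟧ xs) (⟦ f ⟧ ys) ≃∞ 0∞

record MetricAlgebra (Σ' : Signature) : Set₁ where
  field
    Carrier : Set
    d       : Carrier → Carrier → ℝ≥0∞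
    isPM    : IsPseudometric d
    ⟦_⟧     : (f : Op Σ') → (Fin (arity Σ' f) → Carrier) → Carrier
    ⟦⟧-cong : Compatible Σ' ⟦_⟧ d
open MetricAlgebra public

record CongPM {Σ' : Signature} (A : MetricAlgebra Σ') : Set₁ where
  field
    ρ      : Carrier A → Carrier A → ℝ≥0∞
    isPM   : IsPseudometric ρ
    ≤d     : ∀ x y → ρ x y ≤∞ d A x y
    compat : Compatible Σ' (⟦_⟧ A) ρ
open CongPM public

-- the order of Con A: θ₁ ⊑ θ₂ iff θ₁ ≥ θ₂ pointwise
infix 4 _⊑_ _≈Con_
_⊑_ : ∀ {Σ'} {A : MetricAlgebra Σ'} → CongPM A → CongPM A → Set
θ₁ ⊑ θ₂ = ∀ a b → ρ θ₂ a b ≤∞ ρ θ₁ a b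

_≈Con_ : ∀ {Σ'} {A : MetricAlgebra Σ'} → CongPM A → CongPM A → Set
θ₁ ≈Con θ₂ = ∀ a b → ρ θ₁ a b ≃∞ ρ θ₂ a b

-- the quotient metric algebra A/θ (classes of {θ = 0}, metric θ)
_/_ : ∀ {Σ'} (A : MetricAlgebra Σ') → CongPM A → MetricAlgebra Σ'
A / θ = record
  { Carrier = Carrier A
  ; d       = ρ θ
  ; isPM    = isPM θ
  ; ⟦_⟧     = ⟦_⟧ A
  ; ⟦⟧-cong = compat θ
  }

ConAbove : ∀ {Σ'} (A : MetricAlgebra Σ') → CongPM A → Set₁
ConAbove A θ = Σ[ r ∈ CongPM A ] (θ ⊑ r)

_⊑↑_ : ∀ {Σ'} {A : MetricAlgebra Σ'} {θ : CongPM A} →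
       ConAbove A θ → ConAbove A θ → Set
r₁ ⊑↑ r₂ = proj₁ r₁ ⊑ proj₁ r₂

_≈↑_ : ∀ {Σ'} {A : MetricAlgebra Σ'} {θ : CongPM A} →
       ConAbove A θ → ConAbove A θ → Set
r₁ ≈↑ r₂ = proj₁ r₁ ≈Con proj₁ r₂

{-# OPTIONS --safe #-}
module Submission where

open import Defs
open import Data.Product using (∃; _,_)
open import Function.Definitions using (Surjective)
open import Relation.Binary.Morphism.Structures
  using (IsOrderHomomorphism; IsOrderMonomorphism; IsOrderIsomorphism)

-- A congruential pseudometric ρ on A/θ is bounded by the metric θ of A/θ,
-- hence by d, and its zero set is a congruence for the operations of A;
-- conversely a member of Con A above θ is bounded by θ. Since A/θ has the
-- carrier of A, pulling back along the quotient map leaves ρ unchanged, so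
-- both orders and both equalities are preserved and reflected on the nose.

≤∞-trans : ∀ {x y z} → x ≤∞ y → y ≤∞ z → x ≤∞ z
≤∞-trans x≤y y≤z q z<q = x≤y q (y≤z q z<q)

module _ {Σ' : Signature} (A : MetricAlgebra Σ') (θ : CongPM A) where

  pullback : CongPM (A / θ) → ConAbove A θ
  pullback r =
    record { ρ = ρ r ; isPM = isPM r
           ; ≤d = λ x y → ≤∞-trans {ρ r x y} {ρ θ x y} {d A x y}
                                     (≤d r x y) (≤d θ x y)
           ; compat = compat r }
    , ≤d r

  pushforward : ConAbove A θ → CongPM (A / θ)
  pushforward (r , θ⊑r) =
    record { ρ = ρ r ; isPM = isPM r ; ≤d = θ⊑r ; compat = compat r }

  pullback-isOrderHomomorphism :
    IsOrderHomomorphism (_≈Con_ {A = A / θ}) (_≈↑_ {θ = θ})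
      (_⊑_ {A = A / θ}) (_⊑↑_ {θ = θ}) pullback
  pullback-isOrderHomomorphism = record
    { cong = λ r₁≈r₂ → r₁≈r₂
    ; mono = λ r₁⊑r₂ → r₁⊑r₂
    }

  pullback-isOrderMonomorphism :
    IsOrderMonomorphism (_≈Con_ {A = A / θ}) (_≈↑_ {θ = θ})
      (_⊑_ {A = A / θ}) (_⊑↑_ {θ = θ}) pullback
  pullback-isOrderMonomorphism = record
    { isOrderHomomorphism = pullback-isOrderHomomorphism
    ; injective           = λ r₁≈r₂ → r₁≈r₂
    ; cancel              = λ r₁⊑r₂ → r₁⊑r₂
    }

  pullback-surjective :
    Surjective (_≈Con_ {A = A / θ}) (_≈↑_ {θ = θ}) pullback
  pullback-surjective r = pushforward r , λ s≈r → s≈r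

mainTheorem11 : (Σ' : Signature) (A : MetricAlgebra Σ') (θ : CongPM A) →
    ∃ λ (F : CongPM (A / θ) → ConAbove A θ) →
    IsOrderIsomorphism (_≈Con_ {A = A / θ}) (_≈↑_ {θ = θ})
    (_⊑_ {A = A / θ}) (_⊑↑_ {θ = θ}) F
mainTheorem11 Σ' A θ = pullback A θ , record
  { isOrderMonomorphism = pullback-isOrderMonomorphism A θ
  ; surjective          = pullback-surjective A θ
  }
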